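{- For every integer $k\ge 1$, the graph $C_{3k+1}=\langle \mathbb{Z}_2^{3k+1},\{2k+1,2k+2,\dots,3k+1\}\rangle$ satisfies $\mu_2(C_{3k+1})=\binom{2k}{k}$ and $\mu_3(C_{3k+1})=1$.
   Context: For a set $S$ of positive integers, $\langle\mathbb{Z}_2^n,S\rangle$ denotes the graph with vertex set $\mathbb{Z}_2^n$ in which $x\sim y$ iff the Hamming distance $d(x,y)$ lies in $S$. For a graph $G$ and $t\ge1$, $\mu_t(G)$ is the minimum, over all independent sets $A\subseteq V(G)$ with $|A|=t$, of the number of vertices $b\in V(G)$ with $N(b)\supseteq A$, where $N(b)$ is the set of neighbors of $b$. -}

module Defs where

open import Data.Nat using (ℕ; zero; suc; _+_; _≤_; _≤ᵇ_)
open import Data.Bool using (Bool; true; false; _xor_; _∧_; if_then_else_)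
open import Data.Vec using (Vec; []; _∷_)
open import Data.List using (List; []; _∷_; _++_; map; length; filterᵇ; allFin)
open import Data.Bool.ListAction using (all)
open import Data.Fin using (Fin)
open import Data.Product using (Σ; _×_)
open import Relation.Binary.PropositionalEquality using (_≡_; _≢_)
open import Function.Definitions using (Injective)

Vertex : ℕ → Set
Vertex n = Vec Bool n

allVertices : (n : ℕ) → List (Vertex n)
allVertices zero = [] ∷ []
allVertices (suc n) = map (false ∷_) (allVertices n) ++ map (true ∷_) (allVertices n)

hamming : ∀ {n} → Vertex n → Vertex n → ℕ
hamming [] [] = 0
hamming (x ∷ xs) (y ∷ ys) = (if x xor y then 1 else 0) + hamming xs ys

-- A set S of positive integers is given by its characteristic function.
-- Graph ⟨Z_2^n, S⟩ : x ~ y iff d(x,y) ∈ S.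
adjᵇ : (S : ℕ → Bool) → ∀ {n} → Vertex n → Vertex n → Bool
adjᵇ S x y = S (hamming x y)

Adj : (S : ℕ → Bool) → ∀ {n} → Vertex n → Vertex n → Set
Adj S x y = adjᵇ S x y ≡ true

IndepSet : (S : ℕ → Bool) (n t : ℕ) → (Fin t → Vertex n) → Set
IndepSet S n t A = Injective _≡_ _≡_ A × (∀ i j → i ≢ j → adjᵇ S (A i) (A j) ≡ false)

commonNbrCount : (S : ℕ → Bool) (n t : ℕ) → (Fin t → Vertex n) → ℕ
commonNbrCount S n t A =
  length (filterᵇ (λ b → all (λ i → adjᵇ S b (A i)) (allFin t)) (allVertices n))

-- μ_t(⟨Z_2^n,S⟩) = m : m is the minimum of commonNbrCount over independent t-sets
-- (attained, and a lower bound).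
MuIs : (S : ℕ → Bool) (n t m : ℕ) → Set
MuIs S n t m =
  Σ (Fin t → Vertex n) (λ A → IndepSet S n t A × commonNbrCount S n t A ≡ m)
  × (∀ (A : Fin t → Vertex n) → IndepSet S n t A → m ≤ commonNbrCount S n t A)

Sk : ℕ → ℕ → Bool
Sk k d = ((suc (k + k)) ≤ᵇ d) ∧ (d ≤ᵇ suc (k + k + k))

-- A common neighbour of two non-adjacent vertices x, y is a vertex at distance at least 2k+1
-- from both.  Their number depends only on the numbers a and d of coordinates where x and y
-- agree and differ; it is supermodular in the two distance thresholds, so trading a
-- disagreement for an agreement never decreases it, and over d ≤ 2k it is smallest at d = 2k,
-- where it equals C(2k,k).
--
-- For three pairwise non-adjacent vertices the balls of radius k around them pairwise meet,
-- so by the Helly property of Hamming balls they have a common point v, whose antipode is a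
-- common neighbour.  For three vertices at pairwise distance 2k, the distances from any b to
-- them sum to at most 3(2k+1), with equality only when b is the antipode of their median, so
-- that vertex is their only possible common neighbour.

module Submission where

open import Defs
open import Data.Nat using (ℕ; suc; _+_; _≤_)
open import Data.Nat.Combinatorics using (_C_)
open import Data.Product using (_×_)

open import Data.Bool using (Bool; true; false; T; not; _∧_; _xor_; if_then_else_)
open import Data.Bool.ListAction using (all)
open import Data.Bool.Properties using (T-≡; ∧-identityʳ)
open import Data.Fin using (Fin; zero; suc; inject₁)
open import Data.Fin.Properties using (inject₁-injective) renaming (_≟_ to _≟ᶠ_)
open import Data.List using (List; []; _∷_; length; filterᵇ; tabulate; allFin)
  renaming (map to mapᴸ; _++_ to _++ᴸ_)
open import Data.List.Properties using (length-++; filter-++)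
open import Data.Nat using (zero; _*_; _∸_; _<_; _≤ᵇ_; z≤n; s≤s)
open import Data.Nat.Combinatorics using (k>n⇒nCk≡0; nCk+nC[k+1]≡[n+1]C[k+1])
open import Data.Nat.Properties
open import Algebra.Properties.CommutativeSemigroup +-commutativeSemigroup using (interchange)
open import Data.Nat.Tactic.RingSolver using (solve-∀)
open import Data.Product using (_,_; proj₁; proj₂; ∃-syntax)
open import Data.Vec using (Vec; []; _∷_; _++_; replicate; map)
open import Data.Vec.Properties using (∷-injectiveˡ; ∷-injectiveʳ)
open import Function using (_∘_; Equivalence)
open import Function.Definitions using (Injective)
open import Relation.Binary.PropositionalEquality
open import Relation.Nullary using (yes; no; ¬_; contradiction)
open import Relation.Nullary.Decidable using (T?)

-- Counting in the cube

count : {A : Set} → (A → Bool) → List A → ℕ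
count P xs = length (filterᵇ P xs)

count-++ : {A : Set} (P : A → Bool) (xs ys : List A) →
           count P (xs ++ᴸ ys) ≡ count P xs + count P ys
count-++ P xs ys = trans (cong length (filter-++ (T? ∘ P) xs ys)) (length-++ (filterᵇ P xs))

count-map : {A B : Set} (P : B → Bool) (f : A → B) (xs : List A) →
            count P (mapᴸ f xs) ≡ count (P ∘ f) xs
count-map P f [] = refl
count-map P f (x ∷ xs) with P (f x)
... | true  = cong suc (count-map P f xs)
... | false = count-map P f xs

count-cong : {A : Set} {P Q : A → Bool} → (∀ x → P x ≡ Q x) → (xs : List A) →
             count P xs ≡ count Q xs
count-cong P≗Q [] = refl
count-cong {P = P} {Q} P≗Q (x ∷ xs) with P x | Q x | P≗Q x
... | true  | .true  | refl = cong suc (count-cong P≗Q xs)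
... | false | .false | refl = count-cong P≗Q xs

count-none : {A : Set} {P : A → Bool} → (∀ x → P x ≢ true) → (xs : List A) → count P xs ≡ 0
count-none never [] = refl
count-none {P = P} never (x ∷ xs) with P x in Px
... | true  = contradiction Px (never x)
... | false = count-none never xs

count-allVertices-suc : ∀ n (P : Vertex (suc n) → Bool) →
  count P (allVertices (suc n)) ≡
  count (P ∘ (false ∷_)) (allVertices n) + count (P ∘ (true ∷_)) (allVertices n)
count-allVertices-suc n P =
  trans (count-++ P (mapᴸ (false ∷_) (allVertices n)) (mapᴸ (true ∷_) (allVertices n)))
        (cong₂ _+_ (count-map P (false ∷_) (allVertices n)) (count-map P (true ∷_) (allVertices n)))

count-allVertices-pos : ∀ n (P : Vertex n → Bool) (v : Vertex n) → P v ≡ true →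
                        1 ≤ count P (allVertices n)
count-allVertices-pos zero P [] Pv rewrite Pv = s≤s z≤n
count-allVertices-pos (suc n) P (false ∷ v) Pv =
  ≤-trans (≤-trans (count-allVertices-pos n _ v Pv) (m≤m+n _ _))
          (≤-reflexive (sym (count-allVertices-suc n P)))
count-allVertices-pos (suc n) P (true ∷ v) Pv =
  ≤-trans (≤-trans (count-allVertices-pos n _ v Pv) (m≤n+m _ _))
          (≤-reflexive (sym (count-allVertices-suc n P)))

count-allVertices-unique : ∀ n (P : Vertex n → Bool) (w : Vertex n) → P w ≡ true →
                           (∀ v → P v ≡ true → v ≡ w) → count P (allVertices n) ≡ 1
count-allVertices-unique zero P [] Pw _ rewrite Pw = refl
count-allVertices-unique (suc n) P (false ∷ w) Pw only =
  trans (count-allVertices-suc n P)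
        (cong₂ _+_ (count-allVertices-unique n _ w Pw (λ v → ∷-injectiveʳ ∘ only (false ∷ v)))
                   (count-none (λ v e → contradiction (∷-injectiveˡ (only (true ∷ v) e)) λ ())
                               (allVertices n)))
count-allVertices-unique (suc n) P (true ∷ w) Pw only =
  trans (count-allVertices-suc n P)
        (cong₂ _+_ (count-none (λ v e → contradiction (∷-injectiveˡ (only (false ∷ v) e)) λ ())
                               (allVertices n))
                   (count-allVertices-unique n _ w Pw (λ v → ∷-injectiveʳ ∘ only (true ∷ v))))

-- Hamming distance

-- Definitionally the summand of hamming.
bit : Bool → ℕ
bit c = if c then 1 else 0

bit≤1 : ∀ c → bit c ≤ 1
bit≤1 false = z≤n
bit≤1 true  = ≤-refl

hamming-self : ∀ {n} (x : Vertex n) → hamming x x ≡ 0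
hamming-self []          = refl
hamming-self (false ∷ x) = hamming-self x
hamming-self (true ∷ x)  = hamming-self x

hamming≡0⇒≡ : ∀ {n} (x y : Vertex n) → hamming x y ≡ 0 → x ≡ y
hamming≡0⇒≡ [] [] _ = refl
hamming≡0⇒≡ (false ∷ x) (false ∷ y) e = cong (false ∷_) (hamming≡0⇒≡ x y e)
hamming≡0⇒≡ (true ∷ x)  (true ∷ y)  e = cong (true ∷_) (hamming≡0⇒≡ x y e)

hamming-sym : ∀ {n} (x y : Vertex n) → hamming x y ≡ hamming y x
hamming-sym [] [] = refl
hamming-sym (false ∷ x) (false ∷ y) = hamming-sym x y
hamming-sym (false ∷ x) (true ∷ y)  = cong suc (hamming-sym x y)
hamming-sym (true ∷ x)  (false ∷ y) = cong suc (hamming-sym x y)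
hamming-sym (true ∷ x)  (true ∷ y)  = hamming-sym x y

hamming≤n : ∀ {n} (x y : Vertex n) → hamming x y ≤ n
hamming≤n [] [] = z≤n
hamming≤n (a ∷ x) (b ∷ y) = +-mono-≤ (bit≤1 (a xor b)) (hamming≤n x y)

hamming-++ : ∀ {m n} (u u′ : Vec Bool m) (v v′ : Vec Bool n) →
             hamming (u ++ v) (u′ ++ v′) ≡ hamming u u′ + hamming v v′
hamming-++ [] [] v v′ = refl
hamming-++ (a ∷ u) (b ∷ u′) v v′ =
  trans (cong (bit (a xor b) +_) (hamming-++ u u′ v v′)) (sym (+-assoc (bit (a xor b)) _ _))

hamming-replicate : ∀ k a b → hamming (replicate k a) (replicate k b) ≡ (if a xor b then k else 0)
hamming-replicate zero a b with a xor b
... | true  = refl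
... | false = refl
hamming-replicate (suc k) a b with a xor b | hamming-replicate k a b
... | true  | ih = cong suc ih
... | false | ih = ih

hamming-antipode : ∀ {n} (v x : Vertex n) → hamming (map not v) x + hamming v x ≡ n
hamming-antipode [] [] = refl
hamming-antipode (false ∷ v) (false ∷ x) = cong suc (hamming-antipode v x)
hamming-antipode (true ∷ v)  (true ∷ x)  = cong suc (hamming-antipode v x)
hamming-antipode (false ∷ v) (true ∷ x)  = trans (+-suc _ _) (cong suc (hamming-antipode v x))
hamming-antipode (true ∷ v)  (false ∷ x) = trans (+-suc _ _) (cong suc (hamming-antipode v x))

agreements : ∀ {n} → Vertex n → Vertex n → ℕ
agreements [] [] = 0
agreements (a ∷ x) (b ∷ y) = bit (not (a xor b)) + agreements x y

agreements+hamming : ∀ {n} (x y : Vertex n) → agreements x y + hamming x y ≡ n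
agreements+hamming [] [] = refl
agreements+hamming (false ∷ x) (false ∷ y) = cong suc (agreements+hamming x y)
agreements+hamming (true ∷ x)  (true ∷ y)  = cong suc (agreements+hamming x y)
agreements+hamming (false ∷ x) (true ∷ y)  = trans (+-suc _ _) (cong suc (agreements+hamming x y))
agreements+hamming (true ∷ x)  (false ∷ y) = trans (+-suc _ _) (cong suc (agreements+hamming x y))

-- Vertices far from two given vertices

-- farCount a d p q is the number of b with d(b,x) ≥ p and d(b,y) ≥ q, for any x, y
-- that agree in a coordinates and differ in d (countFar≡farCount).
farCount : ℕ → ℕ → ℕ → ℕ → ℕ
farCount zero    zero    zero    zero    = 1
farCount zero    zero    zero    (suc q) = 0
farCount zero    zero    (suc p) q       = 0
farCount zero    (suc d) p       q       = farCount 0 d (p ∸ 1) q + farCount 0 d p (q ∸ 1)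
farCount (suc a) d       p       q       = farCount a d p q + farCount a d (p ∸ 1) (q ∸ 1)

farCount-disagree : ∀ a d p q →
  farCount a (suc d) p q ≡ farCount a d (p ∸ 1) q + farCount a d p (q ∸ 1)
farCount-disagree zero    d p q = refl
farCount-disagree (suc a) d p q =
  trans (cong₂ _+_ (farCount-disagree a d p q) (farCount-disagree a d (p ∸ 1) (q ∸ 1)))
        (interchange (farCount a d (p ∸ 1) q) (farCount a d p (q ∸ 1))
                     (farCount a d (p ∸ 1 ∸ 1) (q ∸ 1)) (farCount a d (p ∸ 1) (q ∸ 1 ∸ 1)))

-- Pointwise, [d(b,x) ≥ p][d(b,y) ≥ q] is supermodular in (p, q).
farCount-supermodular : ∀ a d p q →
  farCount a d p (q ∸ 1) + farCount a d (p ∸ 1) q ≤ farCount a d p q + farCount a d (p ∸ 1) (q ∸ 1)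
farCount-supermodular zero zero zero          zero    = ≤-refl
farCount-supermodular zero zero zero          (suc q) = ≤-reflexive (+-comm (farCount 0 0 0 q) 0)
farCount-supermodular zero zero (suc p)       zero    = ≤-refl
farCount-supermodular zero zero (suc zero)    (suc q) = z≤n
farCount-supermodular zero zero (suc (suc p)) (suc q) = z≤n
farCount-supermodular zero (suc d) p q = begin
  (F (p ∸ 1) (q ∸ 1) + F p (q ∸ 1 ∸ 1)) + (F (p ∸ 1 ∸ 1) q + F (p ∸ 1) (q ∸ 1))
    ≡⟨ interchange (F (p ∸ 1) (q ∸ 1)) (F p (q ∸ 1 ∸ 1)) (F (p ∸ 1 ∸ 1) q) (F (p ∸ 1) (q ∸ 1)) ⟩
  (F (p ∸ 1) (q ∸ 1) + F (p ∸ 1 ∸ 1) q) + (F p (q ∸ 1 ∸ 1) + F (p ∸ 1) (q ∸ 1))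
    ≤⟨ +-mono-≤ (farCount-supermodular zero d (p ∸ 1) q) (farCount-supermodular zero d p (q ∸ 1)) ⟩
  (F (p ∸ 1) q + F (p ∸ 1 ∸ 1) (q ∸ 1)) + (F p (q ∸ 1) + F (p ∸ 1) (q ∸ 1 ∸ 1))
    ≡⟨ interchange (F (p ∸ 1) q) (F (p ∸ 1 ∸ 1) (q ∸ 1)) (F p (q ∸ 1)) (F (p ∸ 1) (q ∸ 1 ∸ 1)) ⟩
  (F (p ∸ 1) q + F p (q ∸ 1)) + (F (p ∸ 1 ∸ 1) (q ∸ 1) + F (p ∸ 1) (q ∸ 1 ∸ 1)) ∎
  where
  open ≤-Reasoning
  F : ℕ → ℕ → ℕ
  F = farCount zero d
farCount-supermodular (suc a) d p q = begin
  (F p (q ∸ 1) + F (p ∸ 1) (q ∸ 1 ∸ 1)) + (F (p ∸ 1) q + F (p ∸ 1 ∸ 1) (q ∸ 1))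
    ≡⟨ interchange (F p (q ∸ 1)) (F (p ∸ 1) (q ∸ 1 ∸ 1)) (F (p ∸ 1) q) (F (p ∸ 1 ∸ 1) (q ∸ 1)) ⟩
  (F p (q ∸ 1) + F (p ∸ 1) q) + (F (p ∸ 1) (q ∸ 1 ∸ 1) + F (p ∸ 1 ∸ 1) (q ∸ 1))
    ≤⟨ +-mono-≤ (farCount-supermodular a d p q) (farCount-supermodular a d (p ∸ 1) (q ∸ 1)) ⟩
  (F p q + F (p ∸ 1) (q ∸ 1)) + (F (p ∸ 1) (q ∸ 1) + F (p ∸ 1 ∸ 1) (q ∸ 1 ∸ 1)) ∎
  where
  open ≤-Reasoning
  F : ℕ → ℕ → ℕ
  F = farCount a d

farCount-agree≥disagree : ∀ a d p q → farCount a (suc d) p q ≤ farCount (suc a) d p q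
farCount-agree≥disagree a d p q =
  ≤-trans (≤-reflexive (trans (farCount-disagree a d p q) (+-comm (farCount a d (p ∸ 1) q) _)))
          (farCount-supermodular a d p q)

farCount-shift : ∀ j a d p q → farCount a (j + d) p q ≤ farCount (j + a) d p q
farCount-shift zero    a d p q = ≤-refl
farCount-shift (suc j) a d p q = begin
  farCount a (suc (j + d)) p q   ≤⟨ farCount-agree≥disagree a (j + d) p q ⟩
  farCount (suc a) (j + d) p q   ≤⟨ farCount-shift j (suc a) d p q ⟩
  farCount (j + suc a) d p q     ≡⟨ cong (λ e → farCount e d p q) (+-suc j a) ⟩
  farCount (suc j + a) d p q     ∎
  where open ≤-Reasoning

farCount-antitone : ∀ {a a′ d d′} p q → d ≤ d′ → a + d ≡ a′ + d′ →
                    farCount a′ d′ p q ≤ farCount a d p q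
farCount-antitone {a} {a′} {d} {d′} p q d≤d′ a+d≡a′+d′ = begin
  farCount a′ d′ p q        ≡⟨ cong (λ e → farCount a′ e p q) (sym (m∸n+n≡m d≤d′)) ⟩
  farCount a′ (j + d) p q   ≤⟨ farCount-shift j a′ d p q ⟩
  farCount (j + a′) d p q   ≡⟨ cong (λ e → farCount e d p q) j+a′≡a ⟩
  farCount a d p q          ∎
  where
  open ≤-Reasoning
  j : ℕ
  j = d′ ∸ d
  j+a′≡a : j + a′ ≡ a
  j+a′≡a = +-cancelʳ-≡ d (j + a′) a (begin-equality
    j + a′ + d    ≡⟨ cong (_+ d) (+-comm j a′) ⟩
    a′ + j + d    ≡⟨ +-assoc a′ j d ⟩
    a′ + (j + d)  ≡⟨ cong (a′ +_) (m∸n+n≡m d≤d′) ⟩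
    a′ + d′       ≡⟨ sym a+d≡a′+d′ ⟩
    a + d         ∎)

-- The sum of the distances from b to x and to y is at most 2a + d.
farCount-vanish : ∀ a d p q → a + a + d < p + q → farCount a d p q ≡ 0
farCount-vanish zero zero zero    (suc q) _ = refl
farCount-vanish zero zero (suc p) q       _ = refl
farCount-vanish zero (suc d) p q d<p+q =
  cong₂ _+_ (farCount-vanish zero d (p ∸ 1) q (≤-pred (≤-trans d<p+q left)))
            (farCount-vanish zero d p (q ∸ 1) (≤-pred (≤-trans d<p+q right)))
  where
  left : p + q ≤ suc (p ∸ 1 + q)
  left = +-monoˡ-≤ q (m≤n+m∸n p 1)
  right : p + q ≤ suc (p + (q ∸ 1))
  right = ≤-trans (+-monoʳ-≤ p (m≤n+m∸n q 1)) (≤-reflexive (+-suc p (q ∸ 1)))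
farCount-vanish (suc a) d p q 2a+d<p+q =
  cong₂ _+_ (farCount-vanish a d p q (m+n≤o⇒n≤o 2 shifted))
            (farCount-vanish a d (p ∸ 1) (q ∸ 1) (+-cancelˡ-≤ 2 _ _ (≤-trans shifted bound)))
  where
  shifted : 2 + (a + a + d) < p + q
  shifted = subst (_< p + q) (cong (λ e → suc e + d) (+-suc a a)) 2a+d<p+q
  bound : p + q ≤ 2 + (p ∸ 1 + (q ∸ 1))
  bound = ≤-trans (+-mono-≤ (m≤n+m∸n p 1) (m≤n+m∸n q 1))
                  (≤-reflexive (cong suc (+-suc (p ∸ 1) (q ∸ 1))))

farCount-tight : ∀ a p q → farCount a (p + q) (a + p) (a + q) ≡ farCount 0 (p + q) p q
farCount-tight zero    p q = refl
farCount-tight (suc a) p q =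
  trans (cong (_+ farCount a (p + q) (a + p) (a + q))
              (farCount-vanish a (p + q) (suc (a + p)) (suc (a + q))
                 (≤-trans (n≤1+n _) (≤-reflexive (total a p q)))))
        (farCount-tight a p q)
  where
  total : ∀ a p q → suc (suc (a + a + (p + q))) ≡ suc (a + p) + suc (a + q)
  total = solve-∀

farCount-binomial : ∀ d p q → p + q ≡ d → farCount 0 d p q ≡ d C p
farCount-binomial zero zero zero refl = refl
farCount-binomial (suc d) zero .(suc d) refl =
  cong₂ _+_ (farCount-vanish 0 d 0 (suc d) ≤-refl) (farCount-binomial d 0 d refl)
farCount-binomial (suc d) (suc p) q p+q≡d = begin-equality
  farCount 0 d p q + farCount 0 d (suc p) (q ∸ 1)
    ≡⟨ cong₂ _+_ (farCount-binomial d p q (suc-injective p+q≡d)) (last q (suc-injective p+q≡d)) ⟩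
  d C p + d C suc p
    ≡⟨ nCk+nC[k+1]≡[n+1]C[k+1] d p ⟩
  suc d C suc p ∎
  where
  open ≤-Reasoning
  last : ∀ q → p + q ≡ d → farCount 0 d (suc p) (q ∸ 1) ≡ d C suc p
  last zero    p+0≡d = trans (farCount-vanish 0 d (suc p) 0 (s≤s (≤-reflexive (sym p+0≡d))))
                             (sym (k>n⇒nCk≡0 (s≤s (≤-reflexive (trans (sym p+0≡d) (+-identityʳ p))))))
  last (suc q) p+q≡d = farCount-binomial d (suc p) q (trans (sym (+-suc p q)) p+q≡d)

farCount-balanced : ∀ k → farCount (suc k) (k + k) (suc (k + k)) (suc (k + k)) ≡ (k + k) C k
farCount-balanced k = trans (farCount-tight (suc k) k k) (farCount-binomial (k + k) k k refl)

≤ᵇ-bit+ : ∀ p c h → (p ≤ᵇ bit c + h) ≡ (p ∸ bit c ≤ᵇ h)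
≤ᵇ-bit+ p             false h = refl
≤ᵇ-bit+ zero          true  h = refl
≤ᵇ-bit+ (suc zero)    true  h = refl
≤ᵇ-bit+ (suc (suc p)) true  h = refl

countFar : ∀ {n} → Vertex n → Vertex n → ℕ → ℕ → ℕ
countFar {n} x y p q = count (λ b → (p ≤ᵇ hamming b x) ∧ (q ≤ᵇ hamming b y)) (allVertices n)

countFar-∷ : ∀ {n} a b (x y : Vertex n) p q →
  countFar (a ∷ x) (b ∷ y) p q ≡
  countFar x y (p ∸ bit a) (q ∸ bit b) + countFar x y (p ∸ bit (not a)) (q ∸ bit (not b))
countFar-∷ {n} a b x y p q =
  trans (count-allVertices-suc n _) (cong₂ _+_ (fixed-head false) (fixed-head true))
  where
  fixed-head : ∀ c →
    count (λ v → (p ≤ᵇ hamming (c ∷ v) (a ∷ x)) ∧ (q ≤ᵇ hamming (c ∷ v) (b ∷ y))) (allVertices n)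
      ≡ countFar x y (p ∸ bit (c xor a)) (q ∸ bit (c xor b))
  fixed-head c =
    count-cong (λ v → cong₂ _∧_ (≤ᵇ-bit+ p (c xor a) (hamming v x)) (≤ᵇ-bit+ q (c xor b) (hamming v y)))
               (allVertices n)

countFar≡farCount : ∀ {n} (x y : Vertex n) p q →
                    countFar x y p q ≡ farCount (agreements x y) (hamming x y) p q
countFar≡farCount [] [] zero    zero    = refl
countFar≡farCount [] [] zero    (suc q) = refl
countFar≡farCount [] [] (suc p) q       = refl
countFar≡farCount (false ∷ x) (false ∷ y) p q =
  trans (countFar-∷ false false x y p q)
        (cong₂ _+_ (countFar≡farCount x y p q) (countFar≡farCount x y (p ∸ 1) (q ∸ 1)))
countFar≡farCount (true ∷ x) (true ∷ y) p q =
  trans (countFar-∷ true true x y p q)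
        (trans (+-comm (countFar x y (p ∸ 1) (q ∸ 1)) _)
               (cong₂ _+_ (countFar≡farCount x y p q) (countFar≡farCount x y (p ∸ 1) (q ∸ 1))))
countFar≡farCount (false ∷ x) (true ∷ y) p q =
  trans (countFar-∷ false true x y p q)
        (trans (+-comm (countFar x y p (q ∸ 1)) _)
               (trans (cong₂ _+_ (countFar≡farCount x y (p ∸ 1) q) (countFar≡farCount x y p (q ∸ 1)))
                      (sym (farCount-disagree (agreements x y) (hamming x y) p q))))
countFar≡farCount (true ∷ x) (false ∷ y) p q =
  trans (countFar-∷ true false x y p q)
        (trans (cong₂ _+_ (countFar≡farCount x y (p ∸ 1) q) (countFar≡farCount x y p (q ∸ 1)))
               (sym (farCount-disagree (agreements x y) (hamming x y) p q)))

-- Vertices far from three given vertices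

majority : Bool → Bool → Bool → Bool
majority false false _ = false
majority true  true  _ = true
majority _     _     c = c

antimedian : ∀ {n} → Vertex n → Vertex n → Vertex n → Vertex n
antimedian [] [] [] = []
antimedian (a ∷ x) (b ∷ y) (c ∷ z) = not (majority a b c) ∷ antimedian x y z

majority-splits : ∀ a b c → let m = majority a b c in
  bit (a xor b) ≡ bit (m xor a) + bit (m xor b) ×
  bit (a xor c) ≡ bit (m xor a) + bit (m xor c) ×
  bit (b xor c) ≡ bit (m xor b) + bit (m xor c)
majority-splits false false c     = refl , refl , refl
majority-splits true  true  c     = refl , refl , refl
majority-splits false true  false = refl , refl , refl
majority-splits false true  true  = refl , refl , refl
majority-splits true  false false = refl , refl , refl
majority-splits true  false true  = refl , refl , refl

m+n+o≤p+q⇒o≤[p∸m]+[q∸n] : ∀ {m n o p q} → m ≤ p → n ≤ q → m + n + o ≤ p + q →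
                          o ≤ (p ∸ m) + (q ∸ n)
m+n+o≤p+q⇒o≤[p∸m]+[q∸n] {m} {n} {o} {p} {q} m≤p n≤q le = +-cancelˡ-≤ (m + n) o _ (begin
  m + n + o                       ≤⟨ le ⟩
  p + q                           ≡⟨ cong₂ _+_ (sym (m+[n∸m]≡n m≤p)) (sym (m+[n∸m]≡n n≤q)) ⟩
  (m + (p ∸ m)) + (n + (q ∸ n))   ≡⟨ interchange m (p ∸ m) n (q ∸ n) ⟩
  (m + n) + ((p ∸ m) + (q ∸ n))   ∎)
  where open ≤-Reasoning

m≤n⇒o≤n∸m⇒m+o≤n : ∀ {m n o} → m ≤ n → o ≤ n ∸ m → m + o ≤ n
m≤n⇒o≤n∸m⇒m+o≤n {m} m≤n o≤n∸m = ≤-trans (+-monoʳ-≤ m o≤n∸m) (≤-reflexive (m+[n∸m]≡n m≤n))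

-- Coordinatewise, follow the majority and charge its cost to the
-- (unique) vertex outvoted there.
three-balls-intersect : ∀ {n} (x y z : Vertex n) (r s t : ℕ) →
  hamming x y ≤ r + s → hamming x z ≤ r + t → hamming y z ≤ s + t →
  ∃[ v ] hamming v x ≤ r × hamming v y ≤ s × hamming v z ≤ t
three-balls-intersect x y z zero s t xy xz yz = x , ≤-reflexive (hamming-self x) , xy , xz
three-balls-intersect x y z (suc r) zero t xy xz yz =
  y , ≤-trans (≤-reflexive (hamming-sym y x)) (subst (hamming x y ≤_) (+-identityʳ _) xy)
    , ≤-reflexive (hamming-self y) , yz
three-balls-intersect x y z (suc r) (suc s) zero xy xz yz =
  z , ≤-trans (≤-reflexive (hamming-sym z x)) (subst (hamming x z ≤_) (+-identityʳ _) xz)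
    , ≤-trans (≤-reflexive (hamming-sym z y)) (subst (hamming y z ≤_) (+-identityʳ _) yz)
    , ≤-reflexive (hamming-self z)
three-balls-intersect [] [] [] (suc r) (suc s) (suc t) _ _ _ = [] , z≤n , z≤n , z≤n
three-balls-intersect (a ∷ x) (b ∷ y) (c ∷ z) (suc r) (suc s) (suc t) xy xz yz =
  extend (three-balls-intersect x y z (suc r ∸ δ a) (suc s ∸ δ b) (suc t ∸ δ c)
            (m+n+o≤p+q⇒o≤[p∸m]+[q∸n] (δ≤ a r) (δ≤ b s) (subst (λ e → e + hamming x y ≤ _) ab xy))
            (m+n+o≤p+q⇒o≤[p∸m]+[q∸n] (δ≤ a r) (δ≤ c t) (subst (λ e → e + hamming x z ≤ _) ac xz))
            (m+n+o≤p+q⇒o≤[p∸m]+[q∸n] (δ≤ b s) (δ≤ c t) (subst (λ e → e + hamming y z ≤ _) bc yz)))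
  where
  m : Bool
  m = majority a b c
  δ : Bool → ℕ
  δ e = bit (m xor e)
  δ≤ : ∀ e r → δ e ≤ suc r
  δ≤ e r = ≤-trans (bit≤1 (m xor e)) (s≤s z≤n)
  ab : bit (a xor b) ≡ δ a + δ b
  ab = proj₁ (majority-splits a b c)
  ac : bit (a xor c) ≡ δ a + δ c
  ac = proj₁ (proj₂ (majority-splits a b c))
  bc : bit (b xor c) ≡ δ b + δ c
  bc = proj₂ (proj₂ (majority-splits a b c))
  extend : (∃[ v ] hamming v x ≤ suc r ∸ δ a × hamming v y ≤ suc s ∸ δ b × hamming v z ≤ suc t ∸ δ c) →
           ∃[ v ] hamming v (a ∷ x) ≤ suc r × hamming v (b ∷ y) ≤ suc s × hamming v (c ∷ z) ≤ suc t
  extend (v , vx , vy , vz) = m ∷ v , m≤n⇒o≤n∸m⇒m+o≤n (δ≤ a r) vx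
                                    , m≤n⇒o≤n∸m⇒m+o≤n (δ≤ b s) vy
                                    , m≤n⇒o≤n∸m⇒m+o≤n (δ≤ c t) vz

-- Summed over the coordinates, the distances from b to x, y, z add up to at most
-- 3n − (d(x,y) + d(x,z) + d(y,z))/2, with equality only at the antimedian.
coordinate-bound : ∀ b x y z →
  2 * (bit (b xor x) + bit (b xor y) + bit (b xor z) + bit (b xor not (majority x y z)))
    + (bit (x xor y) + bit (x xor z) + bit (y xor z)) ≤ 6
coordinate-bound false false false false = ≤ᵇ⇒≤ _ _ _
coordinate-bound false false false true  = ≤ᵇ⇒≤ _ _ _
coordinate-bound false false true  false = ≤ᵇ⇒≤ _ _ _
coordinate-bound false false true  true  = ≤ᵇ⇒≤ _ _ _
coordinate-bound false true  false false = ≤ᵇ⇒≤ _ _ _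
coordinate-bound false true  false true  = ≤ᵇ⇒≤ _ _ _
coordinate-bound false true  true  false = ≤ᵇ⇒≤ _ _ _
coordinate-bound false true  true  true  = ≤ᵇ⇒≤ _ _ _
coordinate-bound true  false false false = ≤ᵇ⇒≤ _ _ _
coordinate-bound true  false false true  = ≤ᵇ⇒≤ _ _ _
coordinate-bound true  false true  false = ≤ᵇ⇒≤ _ _ _
coordinate-bound true  false true  true  = ≤ᵇ⇒≤ _ _ _
coordinate-bound true  true  false false = ≤ᵇ⇒≤ _ _ _
coordinate-bound true  true  false true  = ≤ᵇ⇒≤ _ _ _
coordinate-bound true  true  true  false = ≤ᵇ⇒≤ _ _ _
coordinate-bound true  true  true  true  = ≤ᵇ⇒≤ _ _ _

distance-sum-bound : ∀ {n} (b x y z : Vertex n) →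
  2 * (hamming b x + hamming b y + hamming b z + hamming b (antimedian x y z))
    + (hamming x y + hamming x z + hamming y z) ≤ n * 6
distance-sum-bound [] [] [] [] = z≤n
distance-sum-bound (b₀ ∷ b) (x₀ ∷ x) (y₀ ∷ y) (z₀ ∷ z) =
  ≤-trans (≤-reflexive (regroup (bit (b₀ xor x₀)) (bit (b₀ xor y₀)) (bit (b₀ xor z₀))
                                (bit (b₀ xor not (majority x₀ y₀ z₀)))
                                (bit (x₀ xor y₀)) (bit (x₀ xor z₀)) (bit (y₀ xor z₀))
                                (hamming b x) (hamming b y) (hamming b z) (hamming b (antimedian x y z))
                                (hamming x y) (hamming x z) (hamming y z)))
          (+-mono-≤ (coordinate-bound b₀ x₀ y₀ z₀) (distance-sum-bound b x y z))
  where
  regroup : ∀ a₁ a₂ a₃ a₄ a₅ a₆ a₇ b₁ b₂ b₃ b₄ b₅ b₆ b₇ →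
    2 * ((a₁ + b₁) + (a₂ + b₂) + (a₃ + b₃) + (a₄ + b₄)) + ((a₅ + b₅) + (a₆ + b₆) + (a₇ + b₇))
      ≡ (2 * (a₁ + a₂ + a₃ + a₄) + (a₅ + a₆ + a₇)) + (2 * (b₁ + b₂ + b₃ + b₄) + (b₅ + b₆ + b₇))
  regroup = solve-∀

-- The graph ⟨ℤ₂^(3k+1), {2k+1, …, 3k+1}⟩

≤⇒≤ᵇ≡true : ∀ {m n} → m ≤ n → (m ≤ᵇ n) ≡ true
≤⇒≤ᵇ≡true m≤n = Equivalence.to T-≡ (≤⇒≤ᵇ m≤n)

≤ᵇ≡true⇒≤ : ∀ {m n} → (m ≤ᵇ n) ≡ true → m ≤ n
≤ᵇ≡true⇒≤ {m} {n} e = ≤ᵇ⇒≤ m n (subst T (sym e) _)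

≤ᵇ≡false⇒≰ : ∀ {m n} → (m ≤ᵇ n) ≡ false → ¬ m ≤ n
≤ᵇ≡false⇒≰ e m≤n = subst T e (≤⇒≤ᵇ m≤n)

≰⇒≤ᵇ≡false : ∀ {m n} → ¬ m ≤ n → (m ≤ᵇ n) ≡ false
≰⇒≤ᵇ≡false {m} {n} m≰n with m ≤ᵇ n in e
... | true  = contradiction (≤ᵇ≡true⇒≤ e) m≰n
... | false = refl

∧-≡true : ∀ {a b} → a ∧ b ≡ true → a ≡ true × b ≡ true
∧-≡true {true} {true} _ = refl , refl

all-tabulate⁺ : ∀ {A : Set} {m} (p : A → Bool) (f : Fin m → A) →
                (∀ i → p (f i) ≡ true) → all p (tabulate f) ≡ true
all-tabulate⁺ {m = zero}  p f _ = refl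
all-tabulate⁺ {m = suc m} p f pf = cong₂ _∧_ (pf zero) (all-tabulate⁺ p (f ∘ suc) (pf ∘ suc))

all-tabulate⁻ : ∀ {A : Set} {m} (p : A → Bool) (f : Fin m → A) →
                all p (tabulate f) ≡ true → ∀ i → p (f i) ≡ true
all-tabulate⁻ p f e zero    = proj₁ (∧-≡true e)
all-tabulate⁻ p f e (suc i) = all-tabulate⁻ p (f ∘ suc) (proj₂ (∧-≡true e)) i

IndepSet-∘ : ∀ {S n s t} {A : Fin t → Vertex n} {f : Fin s → Fin t} →
             Injective _≡_ _≡_ f → IndepSet S n t A → IndepSet S n s (A ∘ f)
IndepSet-∘ {f = f} f-inj (A-inj , A-indep) =
  f-inj ∘ A-inj , λ i j i≢j → A-indep (f i) (f j) (i≢j ∘ f-inj)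

module _ (k : ℕ) where

  private
    n : ℕ
    n = suc (k + k + k)

  adjᵇ-Sk : (b x : Vertex n) → adjᵇ (Sk k) b x ≡ (suc (k + k) ≤ᵇ hamming b x)
  adjᵇ-Sk b x =
    trans (cong ((suc (k + k) ≤ᵇ hamming b x) ∧_) (≤⇒≤ᵇ≡true (hamming≤n b x))) (∧-identityʳ _)

  far⇒adjacent : (b x : Vertex n) → suc (k + k) ≤ hamming b x → adjᵇ (Sk k) b x ≡ true
  far⇒adjacent b x far = trans (adjᵇ-Sk b x) (≤⇒≤ᵇ≡true far)

  adjacent⇒far : (b x : Vertex n) → adjᵇ (Sk k) b x ≡ true → suc (k + k) ≤ hamming b x
  adjacent⇒far b x adj = ≤ᵇ≡true⇒≤ (trans (sym (adjᵇ-Sk b x)) adj)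

  close⇒nonadjacent : (x y : Vertex n) → hamming x y ≤ k + k → adjᵇ (Sk k) x y ≡ false
  close⇒nonadjacent x y close = trans (adjᵇ-Sk x y) (≰⇒≤ᵇ≡false (<⇒≱ (s≤s close)))

  nonadjacent⇒close : (x y : Vertex n) → adjᵇ (Sk k) x y ≡ false → hamming x y ≤ k + k
  nonadjacent⇒close x y nonadj = ≤-pred (≰⇒> (≤ᵇ≡false⇒≰ (trans (sym (adjᵇ-Sk x y)) nonadj)))

  far⇒commonNbr : ∀ {t} (A : Fin t → Vertex n) (b : Vertex n) →
                  (∀ i → suc (k + k) ≤ hamming b (A i)) →
                  all (λ i → adjᵇ (Sk k) b (A i)) (allFin t) ≡ true
  far⇒commonNbr A b far = all-tabulate⁺ _ (λ i → i) (λ i → far⇒adjacent b (A i) (far i))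

  commonNbr⇒far : ∀ {t} (A : Fin t → Vertex n) (b : Vertex n) →
                  all (λ i → adjᵇ (Sk k) b (A i)) (allFin t) ≡ true →
                  ∀ i → suc (k + k) ≤ hamming b (A i)
  commonNbr⇒far A b common i = adjacent⇒far b (A i) (all-tabulate⁻ _ (λ i → i) common i)

  independent⇒close : ∀ {t} {A : Fin t → Vertex n} → IndepSet (Sk k) n t A →
                      ∀ i j → i ≢ j → hamming (A i) (A j) ≤ k + k
  independent⇒close {A = A} (_ , indep) i j i≢j = nonadjacent⇒close (A i) (A j) (indep i j i≢j)

  equidistant⇒independent : 1 ≤ k → ∀ {t} (A : Fin t → Vertex n) →
    (∀ i j → i ≢ j → hamming (A i) (A j) ≡ k + k) → IndepSet (Sk k) n t A
  equidistant⇒independent 1≤k A equi =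
    injective , λ i j i≢j → close⇒nonadjacent (A i) (A j) (≤-reflexive (equi i j i≢j))
    where
    injective : Injective _≡_ _≡_ A
    injective {i} {j} Ai≡Aj with i ≟ᶠ j
    ... | yes i≡j = i≡j
    ... | no  i≢j = contradiction (m+n≡0⇒m≡0 k (begin-equality
                      k + k               ≡⟨ sym (equi i j i≢j) ⟩
                      hamming (A i) (A j) ≡⟨ cong (hamming (A i)) (sym Ai≡Aj) ⟩
                      hamming (A i) (A i) ≡⟨ hamming-self (A i) ⟩
                      0                   ∎))
                    (≢-sym (<⇒≢ 1≤k))
      where open ≤-Reasoning

  commonNbrCount₂≡countFar : (A : Fin 2 → Vertex n) →
    commonNbrCount (Sk k) n 2 A ≡ countFar (A zero) (A (suc zero)) (suc (k + k)) (suc (k + k))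
  commonNbrCount₂≡countFar A =
    count-cong (λ b → cong₂ _∧_ (adjᵇ-Sk b (A zero))
                                (trans (cong (_∧ true) (adjᵇ-Sk b (A (suc zero)))) (∧-identityʳ _)))
               (allVertices n)

  agreements+hamming≡[k+1]+2k : (x y : Vertex n) → agreements x y + hamming x y ≡ suc k + (k + k)
  agreements+hamming≡[k+1]+2k x y = trans (agreements+hamming x y) (cong suc (+-assoc k k k))

  binomial≤countFar : (x y : Vertex n) → hamming x y ≤ k + k →
                      (k + k) C k ≤ countFar x y (suc (k + k)) (suc (k + k))
  binomial≤countFar x y close = begin
    (k + k) C k
      ≡⟨ sym (farCount-balanced k) ⟩
    farCount (suc k) (k + k) (suc (k + k)) (suc (k + k))
      ≤⟨ farCount-antitone {a′ = suc k} _ _ close (agreements+hamming≡[k+1]+2k x y) ⟩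
    farCount (agreements x y) (hamming x y) (suc (k + k)) (suc (k + k))
      ≡⟨ sym (countFar≡farCount x y _ _) ⟩
    countFar x y (suc (k + k)) (suc (k + k)) ∎
    where open ≤-Reasoning

  countFar≡binomial : (x y : Vertex n) → hamming x y ≡ k + k →
                      countFar x y (suc (k + k)) (suc (k + k)) ≡ (k + k) C k
  countFar≡binomial x y d≡2k = begin-equality
    countFar x y (suc (k + k)) (suc (k + k))
      ≡⟨ countFar≡farCount x y _ _ ⟩
    farCount (agreements x y) (hamming x y) (suc (k + k)) (suc (k + k))
      ≡⟨ cong₂ (λ a d → farCount a d _ _) a≡k+1 d≡2k ⟩
    farCount (suc k) (k + k) (suc (k + k)) (suc (k + k))
      ≡⟨ farCount-balanced k ⟩
    (k + k) C k ∎
    where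
    open ≤-Reasoning
    a≡k+1 : agreements x y ≡ suc k
    a≡k+1 = +-cancelʳ-≡ (k + k) _ _
              (trans (cong (agreements x y +_) (sym d≡2k)) (agreements+hamming≡[k+1]+2k x y))

  antipode-far : (v x : Vertex n) → hamming v x ≤ k → suc (k + k) ≤ hamming (map not v) x
  antipode-far v x vx = +-cancelʳ-≤ (hamming v x) _ _ (begin
    suc (k + k) + hamming v x           ≤⟨ +-monoʳ-≤ (suc (k + k)) vx ⟩
    n                                   ≡⟨ sym (hamming-antipode v x) ⟩
    hamming (map not v) x + hamming v x ∎)
    where open ≤-Reasoning

  far-from-close-triple : (x y z : Vertex n) →
    hamming x y ≤ k + k → hamming x z ≤ k + k → hamming y z ≤ k + k →
    ∃[ b ] suc (k + k) ≤ hamming b x × suc (k + k) ≤ hamming b y × suc (k + k) ≤ hamming b z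
  far-from-close-triple x y z xy xz yz =
    let v , vx , vy , vz = three-balls-intersect x y z k k k xy xz yz
    in map not v , antipode-far v x vx , antipode-far v y vy , antipode-far v z vz

  far-from-equidistant-triple⇒antimedian : (x y z b : Vertex n) →
    hamming x y ≡ k + k → hamming x z ≡ k + k → hamming y z ≡ k + k →
    suc (k + k) ≤ hamming b x → suc (k + k) ≤ hamming b y → suc (k + k) ≤ hamming b z →
    b ≡ antimedian x y z
  far-from-equidistant-triple⇒antimedian x y z b xy xz yz bx by bz =
    hamming≡0⇒≡ b (antimedian x y z) (m+n≡0⇒m≡0 h (n≤0⇒n≡0 2h≤0))
    where
    open ≤-Reasoning
    h : ℕ
    h = hamming b (antimedian x y z)
    expand : ∀ k h → 2 * (suc (k + k) + suc (k + k) + suc (k + k) + h) + ((k + k) + (k + k) + (k + k))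
                     ≡ suc (k + k + k) * 6 + 2 * h
    expand = solve-∀
    2h≤0 : 2 * h ≤ 0
    2h≤0 = +-cancelˡ-≤ (n * 6) (2 * h) 0 (begin
      n * 6 + 2 * h
        ≡⟨ sym (expand k h) ⟩
      2 * (suc (k + k) + suc (k + k) + suc (k + k) + h) + ((k + k) + (k + k) + (k + k))
        ≤⟨ +-monoˡ-≤ _ (*-monoʳ-≤ 2 (+-monoˡ-≤ h (+-mono-≤ (+-mono-≤ bx by) bz))) ⟩
      2 * (hamming b x + hamming b y + hamming b z + h) + ((k + k) + (k + k) + (k + k))
        ≡⟨ cong (2 * (hamming b x + hamming b y + hamming b z + h) +_)
                (sym (cong₂ _+_ (cong₂ _+_ xy xz) yz)) ⟩
      2 * (hamming b x + hamming b y + hamming b z + h) + (hamming x y + hamming x z + hamming y z)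
        ≤⟨ distance-sum-bound b x y z ⟩
      n * 6
        ≡⟨ sym (+-identityʳ (n * 6)) ⟩
      n * 6 + 0 ∎)

  blocks : Bool → Bool → Bool → Bool → Vertex n
  blocks c u v w = c ∷ (replicate k u ++ replicate k v) ++ replicate k w

  hamming-blocks : ∀ c u v w c′ u′ v′ w′ →
    hamming (blocks c u v w) (blocks c′ u′ v′ w′) ≡
    bit (c xor c′)
      + ((if u xor u′ then k else 0) + (if v xor v′ then k else 0) + (if w xor w′ then k else 0))
  hamming-blocks c u v w c′ u′ v′ w′ =
    cong (bit (c xor c′) +_)
      (trans (hamming-++ (replicate k u ++ replicate k v) (replicate k u′ ++ replicate k v′) _ _)
             (cong₂ _+_ (trans (hamming-++ (replicate k u) (replicate k u′) _ _)
                               (cong₂ _+_ (hamming-replicate k u u′) (hamming-replicate k v v′)))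
                        (hamming-replicate k w w′)))

  triangle : Fin 3 → Vertex n
  triangle zero             = blocks false false false false
  triangle (suc zero)       = blocks false true  true  false
  triangle (suc (suc zero)) = blocks false true  false true

  centre : Vertex n
  centre = blocks true false true true

  hamming-triangle₀₁ : hamming (triangle zero) (triangle (suc zero)) ≡ k + k
  hamming-triangle₀₁ =
    trans (hamming-blocks false false false false false true true false) (+-identityʳ (k + k))

  hamming-triangle₀₂ : hamming (triangle zero) (triangle (suc (suc zero))) ≡ k + k
  hamming-triangle₀₂ =
    trans (hamming-blocks false false false false false true false true) (cong (_+ k) (+-identityʳ k))

  hamming-triangle₁₂ : hamming (triangle (suc zero)) (triangle (suc (suc zero))) ≡ k + k
  hamming-triangle₁₂ = hamming-blocks false true true false false true false true

  triangle-equidistant : ∀ i j → i ≢ j → hamming (triangle i) (triangle j) ≡ k + k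
  triangle-equidistant zero             zero             i≢j = contradiction refl i≢j
  triangle-equidistant zero             (suc zero)       _   = hamming-triangle₀₁
  triangle-equidistant zero             (suc (suc zero)) _   = hamming-triangle₀₂
  triangle-equidistant (suc zero)       zero             _   =
    trans (hamming-sym (triangle (suc zero)) (triangle zero)) hamming-triangle₀₁
  triangle-equidistant (suc zero)       (suc zero)       i≢j = contradiction refl i≢j
  triangle-equidistant (suc zero)       (suc (suc zero)) _   = hamming-triangle₁₂
  triangle-equidistant (suc (suc zero)) zero             _   =
    trans (hamming-sym (triangle (suc (suc zero))) (triangle zero)) hamming-triangle₀₂
  triangle-equidistant (suc (suc zero)) (suc zero)       _   =
    trans (hamming-sym (triangle (suc (suc zero))) (triangle (suc zero))) hamming-triangle₁₂
  triangle-equidistant (suc (suc zero)) (suc (suc zero)) i≢j = contradiction refl i≢j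

  centre-far : ∀ i → hamming centre (triangle i) ≡ suc (k + k)
  centre-far zero             = hamming-blocks true false true true false false false false
  centre-far (suc zero)       =
    trans (hamming-blocks true false true true false true true false)
          (cong (λ e → suc (e + k)) (+-identityʳ k))
  centre-far (suc (suc zero)) =
    trans (hamming-blocks true false true true false true false true) (cong suc (+-identityʳ (k + k)))

  triangle-independent : 1 ≤ k → IndepSet (Sk k) n 3 triangle
  triangle-independent 1≤k = equidistant⇒independent 1≤k triangle triangle-equidistant

  commonNbrCount-pair : commonNbrCount (Sk k) n 2 (triangle ∘ inject₁) ≡ (k + k) C k
  commonNbrCount-pair =
    trans (commonNbrCount₂≡countFar (triangle ∘ inject₁))
          (countFar≡binomial _ _ hamming-triangle₀₁)

  binomial≤commonNbrCount₂ : (A : Fin 2 → Vertex n) → IndepSet (Sk k) n 2 A →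
                             (k + k) C k ≤ commonNbrCount (Sk k) n 2 A
  binomial≤commonNbrCount₂ A indep =
    subst ((k + k) C k ≤_) (sym (commonNbrCount₂≡countFar A))
          (binomial≤countFar _ _ (independent⇒close indep zero (suc zero) λ ()))

  commonNbrCount-triangle : commonNbrCount (Sk k) n 3 triangle ≡ 1
  commonNbrCount-triangle =
    count-allVertices-unique n _ centre (far⇒commonNbr triangle centre (≤-reflexive ∘ sym ∘ centre-far))
      λ b common → trans (antimedian-of b (commonNbr⇒far triangle b common))
                         (sym (antimedian-of centre (≤-reflexive ∘ sym ∘ centre-far)))
    where
    antimedian-of : ∀ b → (∀ i → suc (k + k) ≤ hamming b (triangle i)) →
                    b ≡ antimedian (triangle zero) (triangle (suc zero)) (triangle (suc (suc zero)))
    antimedian-of b far = far-from-equidistant-triple⇒antimedian _ _ _ b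
      hamming-triangle₀₁ hamming-triangle₀₂ hamming-triangle₁₂
      (far zero) (far (suc zero)) (far (suc (suc zero)))

  1≤commonNbrCount₃ : (A : Fin 3 → Vertex n) → IndepSet (Sk k) n 3 A →
                      1 ≤ commonNbrCount (Sk k) n 3 A
  1≤commonNbrCount₃ A indep =
    let b , bx , by , bz = far-from-close-triple (A zero) (A (suc zero)) (A (suc (suc zero)))
                             (close zero (suc zero) λ ()) (close zero (suc (suc zero)) λ ())
                             (close (suc zero) (suc (suc zero)) λ ())
    in count-allVertices-pos n _ b
         (far⇒commonNbr A b λ { zero → bx ; (suc zero) → by ; (suc (suc zero)) → bz })
    where
    close : ∀ i j → i ≢ j → hamming (A i) (A j) ≤ k + k
    close = independent⇒close indep

proposition9 : ∀ (k : ℕ) → 1 ≤ k →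
    MuIs (Sk k) (suc (k + k + k)) 2 ((k + k) C k) × MuIs (Sk k) (suc (k + k + k)) 3 1
proposition9 k 1≤k =
    ( ( triangle k ∘ inject₁
      , IndepSet-∘ {S = Sk k} inject₁-injective (triangle-independent k 1≤k)
      , commonNbrCount-pair k)
    , binomial≤commonNbrCount₂ k)
  , ((triangle k , triangle-independent k 1≤k , commonNbrCount-triangle k) , 1≤commonNbrCount₃ k)
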